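{- Let $r_k,s_k,t_k$ be elements of a commutative ring, let $C^{\gamma,\sigma,\tau}=(c_{i,j})$ be the associated Catalan-Stieltjes matrix, and fix $n\ge1$. Equip the digraph $D^{C_n}$ with weights as follows: for each $m=0,1,\dots,n-1$ independently choose a Type $w_m\in\{1,2,3,4,5\}$ (Type 5 allowed only if there are ring elements $b_k,c_k$ with $r_k=1$, $s_k=b_k+c_k$, $t_{k+1}=b_{k+1}c_k$ for all $k\ge0$) and give the arcs of the block $D^{L_m}$ the weights of that Type; give all connecting arcs weight $1$. Then for all $0\le i,j\le n$, $$c_{i,j}=GF\big(P_{n-i}^{(0)},P_{n-j}^{(n)}\big).$$
   Context: The Catalan-Stieltjes matrix $C^{\gamma,\sigma,\tau}=(c_{i,j})_{i,j\ge0}$ is lower triangular ($c_{i,j}=0$ for $j>i$), with $c_{0,0}=1$, $c_{i,0}=s_0c_{i-1,0}+t_1c_{i-1,1}$ and $c_{i,j}=r_{j-1}c_{i-1,j-1}+s_jc_{i-1,j}+t_{j+1}c_{i-1,j+1}$ for $i,j\ge1$. Conventions: $r_{ -1}=t_0=0$. For $m\ge0$ the block $D^{L_m}$ has vertices $P_i^{(m)},Q_i^{(m)},P_i^{(m+1)}$ ($0\le i\le m+1$) and arcs: $P_k^{(m)}\to Q_k^{(m)}$, $Q_k^{(m)}\to P_k^{(m+1)}$ ($0\le k\le m+1$); $P_k^{(m)}\to Q_{k+1}^{(m)}$, $Q_k^{(m)}\to P_{k+1}^{(m+1)}$, $P_k^{(m)}\to P_{k+1}^{(m+1)}$ ($0\le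 k\le m$). The digraph $D^{C_n}$ is the union of the blocks $D^{L_0},\dots,D^{L_{n-1}}$ (vertices with the same name identified) together with the connecting arcs $P_i^{(m)}\to P_i^{(m+1)}$ for $0\le m\le n-1$ and $m+2\le i\le n$ (with the needed vertices added). $GF(u,v)$ denotes the sum over directed paths from $u$ to $v$ of the product of arc weights, $GF(u,u)=1$. Weights on block $D^{L_m}$ (for $0\le k\le m$ unless stated; unlisted arcs of the block get weight $1$): Type 1: $P_k^{(m)}\to Q_k^{(m)}$: $r_{m-k}$; $P_k^{(m)}\to Q_{k+1}^{(m)}$: $t_{m-k}$; $P_k^{(m)}\to P_{k+1}^{(m+1)}$: $s_{m-k}-r_{m-k}-t_{m-k}$. Type 2: $Q_k^{(m)}\to P_k^{(m+1)}$: $r_{m-k}$; $Q_k^{(m)}\to P_{k+1}^{(m+1)}$: $t_{m-k+1}$; $P_k^{(m)}\to P_{k+1}^{(m+1)}$: $s_{m-k}-r_{m-k-1}-t_{m-k+1}$; $P_m^{(m)}\to Q_{m+1}^{(m)}$: $0$. Type 3: $Q_k^{(m)}\to P_k^{(m+1)}$: $r_{m-k}$; $P_k^{(m)}\to Q_{k+1}^{(m)}$: $t_{m-k}$; $P_k^{(m)}\to P_{k+1}^{(m+1)}$: $s_{m-k}-r_{m-k-1}t_{m-k}-1$. Type 4: $P_k^{(m)}\to Q_k^{(m)}$: $r_{m-k}$; $Q_k^{(m)}\to P_{k+1}^{(m+1)}$: $t_{m-k+1}$; $P_k^{(m)}\to P_{k+1}^{(m+1)}$: $s_{m-k}-r_{m-k}t_{m-k+1}-1$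 for $0\le k\le m-1$; $P_m^{(m)}\to P_{m+1}^{(m+1)}$: $s_0-r_0t_1$; $P_m^{(m)}\to Q_{m+1}^{(m)}$: $0$. Type 5: $P_k^{(m)}\to Q_{k+1}^{(m)}$: $b_{m-k}$; $Q_k^{(m)}\to P_{k+1}^{(m+1)}$: $c_{m-k}$; $P_k^{(m)}\to P_{k+1}^{(m+1)}$: $0$. -}

module Defs where

open import Level using (_⊔_)
open import Algebra.Bundles using (CommutativeRing)
open import Data.Nat as ℕ using (ℕ; zero; suc; _∸_; _<ᵇ_; _≡ᵇ_)
open import Data.Bool using (Bool; true; false; if_then_else_; _∧_)
open import Data.List using (List; []; _∷_; map; concatMap; foldr; upTo)
open import Data.Product using (_×_; _,_)

-- Vertices of D^{C_n}:  P m i  is  P_i^{(m)},  Q m i  is  Q_i^{(m)}.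
data Vertex : Set where
  P Q : ℕ → ℕ → Vertex

_==V_ : Vertex → Vertex → Bool
P m i ==V P m' i' = (m ≡ᵇ m') ∧ (i ≡ᵇ i')
Q m i ==V Q m' i' = (m ≡ᵇ m') ∧ (i ≡ᵇ i')
_ ==V _ = false

data BlockType : Set where
  type1 type2 type3 type4 type5 : BlockType

module CatalanStieltjes {c ℓ} (R : CommutativeRing c ℓ) where
  open CommutativeRing R

  -- r_{j-1} with the convention r_{-1} = 0 :  rPrev r j = r_{j-1}
  rPrev : (ℕ → Carrier) → ℕ → Carrier
  rPrev r zero = 0#
  rPrev r (suc j) = r j

  -- t_k with the convention t_0 = 0 (the value t 0 of the given sequence is never used)
  tConv : (ℕ → Carrier) → ℕ → Carrier
  tConv t zero = 0#
  tConv t (suc k) = t (suc k)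

  csMatrix : (r s t : ℕ → Carrier) → ℕ → ℕ → Carrier
  csMatrix r s t zero zero = 1#
  csMatrix r s t zero (suc j) = 0#
  csMatrix r s t (suc i) j =
    if suc i <ᵇ j then 0# else entry j
    where
    entry : ℕ → Carrier
    entry zero = s 0 * csMatrix r s t i 0 + t 1 * csMatrix r s t i 1
    entry (suc j) = r j * csMatrix r s t i j
                    + s (suc j) * csMatrix r s t i (suc j)
                    + t (suc (suc j)) * csMatrix r s t i (suc (suc j))

  Type5Cond : (r s t b cc : ℕ → Carrier) → Set ℓ
  Type5Cond r s t b cc =
    (k : ℕ) → (r k ≈ 1#) × (s k ≈ b k + cc k) × (t (suc k) ≈ b (suc k) * cc k)

  module Digraph (r s t b cc : ℕ → Carrier) (n : ℕ) (w : ℕ → BlockType) where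

    T : ℕ → Carrier
    T = tConv t

    R- : ℕ → Carrier
    R- = rPrev r

    -- weights of the arcs of block D^{L_m} leaving P_k^{(m)}, for 0 ≤ k ≤ m,
    -- in the order  P_k→Q_k,  P_k→Q_{k+1},  P_k→P_{k+1}^{(m+1)}
    pWeights : BlockType → (m k : ℕ) → Carrier × Carrier × Carrier
    pWeights type1 m k = let d = m ∸ k in
      r d , T d , s d - r d - T d
    pWeights type2 m k = let d = m ∸ k in
      1# , (if k ≡ᵇ m then 0# else 1#) , s d - R- d - T (suc d)
    pWeights type3 m k = let d = m ∸ k in
      1# , T d , s d - R- d * T d - 1#
    pWeights type4 m k = let d = m ∸ k in
      r d , (if k ≡ᵇ m then 0# else 1#) ,
      (if k ≡ᵇ m then s 0 - r 0 * T 1 else s d - r d * T (suc d) - 1#)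
    pWeights type5 m k = let d = m ∸ k in
      1# , b d , 0#

    -- weights of the arcs of block D^{L_m} leaving Q_k^{(m)}, for 0 ≤ k ≤ m,
    -- in the order  Q_k→P_k^{(m+1)},  Q_k→P_{k+1}^{(m+1)}
    qWeights : BlockType → (m k : ℕ) → Carrier × Carrier
    qWeights type1 m k = 1# , 1#
    qWeights type2 m k = let d = m ∸ k in r d , T (suc d)
    qWeights type3 m k = let d = m ∸ k in r d , 1#
    qWeights type4 m k = let d = m ∸ k in 1# , T (suc d)
    qWeights type5 m k = let d = m ∸ k in 1# , cc d

    -- outgoing weighted arcs of each vertex of D^{C_n}
    -- (blocks D^{L_0},…,D^{L_{n-1}} plus connecting arcs of weight 1;
    --  block arcs at k = m+1 are unlisted in every Type, hence weight 1)
    out : Vertex → List (Vertex × Carrier)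
    out (P m k) =
      if m <ᵇ n then
        (if k <ᵇ suc m then
           (let (x , y , z) = pWeights (w m) m k in
             (Q m k , x) ∷ (Q m (suc k) , y) ∷ (P (suc m) (suc k) , z) ∷ [])
         else if k ≡ᵇ suc m then (Q m k , 1#) ∷ []
         else if k <ᵇ suc n then (P (suc m) k , 1#) ∷ []
         else [])
      else []
    out (Q m k) =
      if m <ᵇ n then
        (if k <ᵇ suc m then
           (let (x , y) = qWeights (w m) m k in
             (P (suc m) k , x) ∷ (P (suc m) (suc k) , y) ∷ [])
         else if k ≡ᵇ suc m then (P (suc m) k , 1#) ∷ []
         else [])
      else []

    pathsFrom : ℕ → Vertex → List (Vertex × Carrier)
    pathsFrom zero u = (u , 1#) ∷ []
    pathsFrom (suc l) u =
      concatMap (λ { (x , a) → map (λ { (v , p) → (v , a * p) }) (pathsFrom l x) }) (out u)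

    sumEndingAt : Vertex → List (Vertex × Carrier) → Carrier
    sumEndingAt v = foldr (λ { (x , p) acc → (if x ==V v then p else 0#) + acc }) 0#

    -- Every arc raises the rank (P_i^{(m)} ↦ 2m, Q_i^{(m)} ↦ 2m+1) and ranks lie in
    -- [0, 2n], so every path has at most 2n arcs: summing over lengths 0..2n is the
    -- sum over all paths (the length-0 path gives GF(u,u) = 1).
    GF : Vertex → Vertex → Carrier
    GF u v = foldr (λ l acc → sumEndingAt v (pathsFrom l u) + acc) 0# (upTo (suc (n ℕ.+ n)))

-- c_{i,j} is the total weight of the Motzkin paths of length i from height 0 to
-- height j (an up step from height h weighs r_h, a level step s_h, a down step
-- t_h). Since c_{i,j} is defined through the last step of such a path whereas a
-- path in D^{C_n} is unfolded along its first arc, both recursions for these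
-- weights are needed. Put P_k^{(m)} (k ≤ m) at height m − k: for each of the five
-- Types, the paths through the block D^{L_m} from P_k^{(m)} to P_k^{(m+1)},
-- P_{k+1}^{(m+1)}, P_{k+2}^{(m+1)} have total weights r_d, s_d, t_d (d = m − k),
-- so the block performs one Motzkin step, while a vertex P_k^{(m)} with k > m
-- leads without branching to P_k^{(k)}, at height 0. Hence
-- GF(P_{n−i}^{(0)}, P_{n−j}^{(n)}) is the weight of the Motzkin paths of length i
-- from height 0 to height j.
module Submission where

open import Defs
open import Algebra.Bundles using (CommutativeRing)
open import Data.Nat using (ℕ; _≤_; _<_; _∸_)
open import Relation.Binary.PropositionalEquality using (_≡_)

open import Data.Nat.Base as ℕ using (zero; suc; pred; _<ᵇ_; _≡ᵇ_; s≤s)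
import Data.Nat.Properties as ℕ
open import Data.Nat.Properties using (_<?_; _≟_)
open import Data.Bool.Base as Bool using (Bool; true; false; if_then_else_)
open import Data.Unit.Base using (tt)
open import Relation.Nullary.Decidable using (dec-true; dec-false; does-⇔)
open import Function.Bundles using (mk⇔)
open import Data.Sum.Base using (inj₁; inj₂)
open import Data.Empty using (⊥-elim)
import Relation.Binary.PropositionalEquality as ≡
open import Data.List.Base using (List; []; _∷_; _++_; map; concatMap; foldr; applyUpTo)
open import Data.Product.Base using (_×_; _,_; proj₁; proj₂)
open import Data.Fin.Base using (Fin; toℕ)

module RingIdentities {c ℓ} (R : CommutativeRing c ℓ) where
  open CommutativeRing R
  open import Algebra.Solver.Ring.NaturalCoefficients.Default commutativeSemiring
  open import Algebra.Properties.AbelianGroup +-abelianGroup using (//-rightDividesˡ)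

  x-y+y≈x : ∀ x y → x - y + y ≈ x
  x-y+y≈x x y = //-rightDividesˡ y x

  x+[s-x]≈s : ∀ {a x} s → a ≈ x → a + (s - x) ≈ s
  x+[s-x]≈s {a} {x} s a≈x = trans (+-comm a _) (trans (+-congˡ a≈x) (x-y+y≈x s x))

  x+y+[s-x-y]≈s : ∀ {a b x y} s → a + b ≈ x + y → a + b + (s - x - y) ≈ s
  x+y+[s-x-y]≈s {a} {b} {x} {y} s ab≈xy = begin
    a + b + (s - x - y)   ≈⟨ +-cong ab≈xy refl ⟩
    x + y + (s - x - y)   ≈⟨ solve 4 (λ x y u v → x :+ y :+ (u :+ v) := u :+ v :+ y :+ x) refl x y (s - x) (- y) ⟩
    s - x - y + y + x     ≈⟨ +-congʳ (x-y+y≈x (s - x) y) ⟩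
    s - x + x             ≈⟨ x-y+y≈x s x ⟩
    s                     ∎
    where open import Relation.Binary.Reasoning.Setoid setoid

  collect₃ : ∀ x y z q₁ q₂ q₁′ q₂′ A B C →
    x * (q₁ * A + q₂ * B) + (y * (q₁′ * B + q₂′ * C) + (z * B + 0#))
      ≈ x * q₁ * A + (x * q₂ + y * q₁′ + z) * B + y * q₂′ * C
  collect₃ = solve 10 (λ x y z q₁ q₂ q₁′ q₂′ A B C →
    x :* (q₁ :* A :+ q₂ :* B) :+ (y :* (q₁′ :* B :+ q₂′ :* C) :+ (z :* B :+ con 0))
      := x :* q₁ :* A :+ (x :* q₂ :+ y :* q₁′ :+ z) :* B :+ y :* q₂′ :* C) refl

  collect₂ : ∀ x y z q₁ q₂ A B →
    x * (q₁ * A + q₂ * B) + (y * B + (z * B + 0#)) ≈ x * q₁ * A + (x * q₂ + y + z) * B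
  collect₂ = solve 7 (λ x y z q₁ q₂ A B →
    x :* (q₁ :* A :+ q₂ :* B) :+ (y :* B :+ (z :* B :+ con 0))
      := x :* q₁ :* A :+ (x :* q₂ :+ y :+ z) :* B) refl

  interchange : ∀ a₁ a₂ a₃ b₁ b₂ b₃ w₁₁ w₁₂ w₁₃ w₂₁ w₂₂ w₂₃ w₃₁ w₃₂ w₃₃ →
    a₁ * (b₁ * w₁₁ + b₂ * w₁₂ + b₃ * w₁₃) + a₂ * (b₁ * w₂₁ + b₂ * w₂₂ + b₃ * w₂₃)
      + a₃ * (b₁ * w₃₁ + b₂ * w₃₂ + b₃ * w₃₃)
    ≈ b₁ * (a₁ * w₁₁ + a₂ * w₂₁ + a₃ * w₃₁) + b₂ * (a₁ * w₁₂ + a₂ * w₂₂ + a₃ * w₃₂)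
      + b₃ * (a₁ * w₁₃ + a₂ * w₂₃ + a₃ * w₃₃)
  interchange = solve 15 (λ a₁ a₂ a₃ b₁ b₂ b₃ w₁₁ w₁₂ w₁₃ w₂₁ w₂₂ w₂₃ w₃₁ w₃₂ w₃₃ →
    a₁ :* (b₁ :* w₁₁ :+ b₂ :* w₁₂ :+ b₃ :* w₁₃)
      :+ a₂ :* (b₁ :* w₂₁ :+ b₂ :* w₂₂ :+ b₃ :* w₂₃)
      :+ a₃ :* (b₁ :* w₃₁ :+ b₂ :* w₃₂ :+ b₃ :* w₃₃)
    := b₁ :* (a₁ :* w₁₁ :+ a₂ :* w₂₁ :+ a₃ :* w₃₁)
      :+ b₂ :* (a₁ :* w₁₂ :+ a₂ :* w₂₂ :+ a₃ :* w₃₂)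
      :+ b₃ :* (a₁ :* w₁₃ :+ a₂ :* w₂₃ :+ a₃ :* w₃₃)) refl

module Motzkin {c ℓ} (R : CommutativeRing c ℓ) (r s t : ℕ → CommutativeRing.Carrier R) where
  open CommutativeRing R hiding (zero)
  open CatalanStieltjes R
  open RingIdentities R using (interchange)
  open import Relation.Binary.Reasoning.Setoid setoid

  δ : ℕ → ℕ → Carrier
  δ d e = if d ≡ᵇ e then 1# else 0#

  δ-transport : ∀ (f : ℕ → Carrier) d e → f d * δ d e ≈ f e * δ d e
  δ-transport f zero    zero    = refl
  δ-transport f zero    (suc e) = trans (zeroʳ _) (sym (zeroʳ _))
  δ-transport f (suc d) zero    = trans (zeroʳ _) (sym (zeroʳ _))
  δ-transport f (suc d) (suc e) = δ-transport (λ x → f (suc x)) d e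

  δ-off : ∀ {d e} → d < e → δ d e ≡ 0#
  δ-off {zero}  {suc e} _         = ≡.refl
  δ-off {suc d} {suc e} (s≤s d<e) = δ-off d<e

  motzkin : ℕ → ℕ → ℕ → Carrier
  motzkin zero    d e = δ d e
  motzkin (suc N) d e =
    r d * motzkin N (suc d) e + s d * motzkin N d e + tConv t d * motzkin N (pred d) e

  δ-up : ∀ d e → r d * δ (suc d) e ≈ rPrev r e * δ d (pred e)
  δ-up d zero    = trans (zeroʳ _) (sym (zeroˡ _))
  δ-up d (suc e) = δ-transport r d e

  δ-down : ∀ d e → tConv t d * δ (pred d) e ≈ t (suc e) * δ d (suc e)
  δ-down zero    e = trans (zeroˡ _) (sym (zeroʳ _))
  δ-down (suc d) e = δ-transport (λ x → t (suc x)) d e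

  lastStep : (ℕ → Carrier) → ℕ → Carrier
  lastStep f e = rPrev r e * f (pred e) + s e * f e + t (suc e) * f (suc e)

  motzkin-suc-lastStep : ∀ N d e → motzkin (suc N) d e ≈ lastStep (motzkin N d) e
  motzkin-suc-lastStep zero d e = +-cong (+-cong (δ-up d e) (δ-transport s d e)) (δ-down d e)
  motzkin-suc-lastStep (suc N) d e = begin
    r d * motzkin (suc N) (suc d) e + s d * motzkin (suc N) d e
      + tConv t d * motzkin (suc N) (pred d) e
      ≈⟨ +-cong (+-cong (*-congˡ (motzkin-suc-lastStep N (suc d) e)) (*-congˡ (motzkin-suc-lastStep N d e)))
                (*-congˡ (motzkin-suc-lastStep N (pred d) e)) ⟩
    r d * lastStep (motzkin N (suc d)) e + s d * lastStep (motzkin N d) e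
      + tConv t d * lastStep (motzkin N (pred d)) e
      ≈⟨ interchange _ _ _ _ _ _ _ _ _ _ _ _ _ _ _ ⟩
    lastStep (motzkin (suc N) d) e ∎

  motzkin-unreachable : ∀ N d e → d ℕ.+ N < e → motzkin N d e ≈ 0#
  motzkin-unreachable zero    d e lt = reflexive (δ-off (≡.subst (_< e) (ℕ.+-identityʳ d) lt))
  motzkin-unreachable (suc N) d e lt = begin
    r d * motzkin N (suc d) e + s d * motzkin N d e + tConv t d * motzkin N (pred d) e
      ≈⟨ +-cong (+-cong (*-congˡ (motzkin-unreachable N (suc d) e up))
                        (*-congˡ (motzkin-unreachable N d e level)))
                (*-congˡ (motzkin-unreachable N (pred d) e down)) ⟩
    r d * 0# + s d * 0# + tConv t d * 0#
      ≈⟨ +-cong (+-cong (zeroʳ _) (zeroʳ _)) (zeroʳ _) ⟩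
    0# + 0# + 0#
      ≈⟨ trans (+-identityʳ _) (+-identityʳ _) ⟩
    0# ∎
    where
    up : suc d ℕ.+ N < e
    up = ≡.subst (_< e) (ℕ.+-suc d N) lt
    level : d ℕ.+ N < e
    level = ℕ.<-trans (ℕ.n<1+n _) up
    down : pred d ℕ.+ N < e
    down = ℕ.≤-<-trans (ℕ.+-monoˡ-≤ N ℕ.pred[n]≤n) level

  csMatrix≈motzkin : ∀ i j → csMatrix r s t i j ≈ motzkin i 0 j
  csMatrix≈motzkin zero    zero    = refl
  csMatrix≈motzkin zero    (suc j) = refl
  csMatrix≈motzkin (suc i) zero    = begin
    s 0 * csMatrix r s t i 0 + t 1 * csMatrix r s t i 1
      ≈⟨ +-cong (*-congˡ (csMatrix≈motzkin i 0)) (*-congˡ (csMatrix≈motzkin i 1)) ⟩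
    s 0 * motzkin i 0 0 + t 1 * motzkin i 0 1
      ≈⟨ +-congʳ (sym (trans (+-congʳ (zeroˡ _)) (+-identityˡ _))) ⟩
    lastStep (motzkin i 0) 0
      ≈⟨ motzkin-suc-lastStep i 0 0 ⟨
    motzkin (suc i) 0 0 ∎
  csMatrix≈motzkin (suc i) (suc j) with i <ᵇ j in i<j
  ... | true  = sym (motzkin-unreachable (suc i) 0 (suc j) (s≤s (ℕ.<ᵇ⇒< i j (≡.subst Bool.T (≡.sym i<j) tt))))
  ... | false = begin
    r j * csMatrix r s t i j + s (suc j) * csMatrix r s t i (suc j)
      + t (suc (suc j)) * csMatrix r s t i (suc (suc j))
      ≈⟨ +-cong (+-cong (*-congˡ (csMatrix≈motzkin i j)) (*-congˡ (csMatrix≈motzkin i (suc j))))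
                (*-congˡ (csMatrix≈motzkin i (suc (suc j)))) ⟩
    lastStep (motzkin i 0) (suc j)
      ≈⟨ motzkin-suc-lastStep i 0 (suc j) ⟨
    motzkin (suc i) 0 (suc j) ∎

module PathSums {c ℓ} (R : CommutativeRing c ℓ) (r s t b cc : ℕ → CommutativeRing.Carrier R)
                (n : ℕ) (w : ℕ → BlockType) where
  open CommutativeRing R hiding (zero)
  open CatalanStieltjes R
  open Digraph r s t b cc n w
  open import Algebra.Properties.Semiring.Sum semiring
    using (sum; sum-cong-≋; ∑-distrib-+; *-distribˡ-sum; sum-replicate-zero)
  open import Relation.Binary.Reasoning.Setoid setoid

  sumOver : List (Vertex × Carrier) → (Vertex → Carrier) → Carrier
  sumOver []             f = 0#
  sumOver ((x , a) ∷ xs) f = a * f x + sumOver xs f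

  sumOver-cong : ∀ xs {f g : Vertex → Carrier} → (∀ x → f x ≈ g x) → sumOver xs f ≈ sumOver xs g
  sumOver-cong []             f≈g = refl
  sumOver-cong ((x , a) ∷ xs) f≈g = +-cong (*-congˡ (f≈g x)) (sumOver-cong xs f≈g)

  lengthGF : ℕ → Vertex → Vertex → Carrier
  lengthGF l u v = sumEndingAt v (pathsFrom l u)

  sumEndingAt-++ : ∀ v xs ys → sumEndingAt v (xs ++ ys) ≈ sumEndingAt v xs + sumEndingAt v ys
  sumEndingAt-++ v []             ys = sym (+-identityˡ _)
  sumEndingAt-++ v ((x , p) ∷ xs) ys = trans (+-congˡ (sumEndingAt-++ v xs ys)) (sym (+-assoc _ _ _))

  -- Stated for any g behaving like the pattern lambda in pathsFrom, which cannot be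
  -- written down again up to definitional equality.
  sumEndingAt-scale : ∀ v a (g : Vertex × Carrier → Vertex × Carrier) → (∀ x p → g (x , p) ≡ (x , a * p)) →
                      ∀ ps → sumEndingAt v (map g ps) ≈ a * sumEndingAt v ps
  sumEndingAt-scale v a g g-scales []             = sym (zeroʳ a)
  sumEndingAt-scale v a g g-scales ((x , p) ∷ ps) rewrite g-scales x p = begin
    (if x ==V v then a * p else 0#) + sumEndingAt v (map g ps)
      ≈⟨ +-cong (if-scale (x ==V v)) (sumEndingAt-scale v a g g-scales ps) ⟩
    a * (if x ==V v then p else 0#) + a * sumEndingAt v ps
      ≈⟨ distribˡ a _ _ ⟨
    a * sumEndingAt v ((x , p) ∷ ps) ∎
    where
    if-scale : ∀ bo → (if bo then a * p else 0#) ≈ a * (if bo then p else 0#)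
    if-scale true  = refl
    if-scale false = sym (zeroʳ a)

  sumEndingAt-concatMap : ∀ v (F : Vertex × Carrier → List (Vertex × Carrier)) (g : Vertex → Carrier) →
                          (∀ x a → sumEndingAt v (F (x , a)) ≈ a * g x) →
                          ∀ xs → sumEndingAt v (concatMap F xs) ≈ sumOver xs g
  sumEndingAt-concatMap v F g F≈ []             = refl
  sumEndingAt-concatMap v F g F≈ ((x , a) ∷ xs) =
    trans (sumEndingAt-++ v (F (x , a)) (concatMap F xs))
          (+-cong (F≈ x a) (sumEndingAt-concatMap v F g F≈ xs))

  lengthGF-suc : ∀ l u v → lengthGF (suc l) u v ≈ sumOver (out u) (λ x → lengthGF l x v)
  lengthGF-suc l u v = sumEndingAt-concatMap v _ (λ x → lengthGF l x v)
    (λ x a → sumEndingAt-scale v a _ (λ _ _ → ≡.refl) (pathsFrom l x)) (out u)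

  GF< : ℕ → Vertex → Vertex → Carrier
  GF< zero    u v = 0#
  GF< (suc L) u v = (if u ==V v then 1# else 0#) + sumOver (out u) (λ x → GF< L x v)

  sum-sumOver-comm : ∀ {L} xs (F : Fin L → Vertex → Carrier) →
                     sum (λ l → sumOver xs (F l)) ≈ sumOver xs (λ x → sum (λ l → F l x))
  sum-sumOver-comm {L} []             F = sum-replicate-zero L
  sum-sumOver-comm {L} ((x , a) ∷ xs) F = begin
    sum (λ l → a * F l x + sumOver xs (F l))
      ≈⟨ ∑-distrib-+ (λ l → a * F l x) (λ l → sumOver xs (F l)) ⟩
    sum (λ l → a * F l x) + sum (λ l → sumOver xs (F l))
      ≈⟨ +-cong (sym (*-distribˡ-sum a (λ l → F l x))) (sum-sumOver-comm xs F) ⟩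
    a * sum (λ l → F l x) + sumOver xs (λ y → sum (λ l → F l y)) ∎

  sum-lengthGF : ∀ L u v → sum {L} (λ l → lengthGF (toℕ l) u v) ≈ GF< L u v
  sum-lengthGF zero    u v = refl
  sum-lengthGF (suc L) u v = +-cong (+-identityʳ _) (begin
    sum {L} (λ l → lengthGF (suc (toℕ l)) u v)
      ≈⟨ sum-cong-≋ {L} (λ l → lengthGF-suc (toℕ l) u v) ⟩
    sum {L} (λ l → sumOver (out u) (λ x → lengthGF (toℕ l) x v))
      ≈⟨ sum-sumOver-comm {L} (out u) (λ l x → lengthGF (toℕ l) x v) ⟩
    sumOver (out u) (λ x → sum {L} (λ l → lengthGF (toℕ l) x v))
      ≈⟨ sumOver-cong (out u) (λ x → sum-lengthGF L x v) ⟩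
    sumOver (out u) (λ x → GF< L x v) ∎)

  foldr-applyUpTo : ∀ (h : ℕ → Carrier) (f : ℕ → ℕ) L →
    foldr (λ l acc → h l + acc) 0# (applyUpTo f L) ≡ sum {L} (λ l → h (f (toℕ l)))
  foldr-applyUpTo h f zero    = ≡.refl
  foldr-applyUpTo h f (suc L) = ≡.cong (h (f 0) +_) (foldr-applyUpTo h (λ l → f (suc l)) L)

  GF≈GF< : ∀ u v → GF u v ≈ GF< (suc (n ℕ.+ n)) u v
  GF≈GF< u v = trans (reflexive (foldr-applyUpTo (λ l → lengthGF l u v) (λ l → l) (suc (n ℕ.+ n))))
                     (sum-lengthGF (suc (n ℕ.+ n)) u v)

module DigraphGF {c ℓ} (R : CommutativeRing c ℓ) (r s t b cc : ℕ → CommutativeRing.Carrier R)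
                (n : ℕ) (w : ℕ → BlockType) where
  open CommutativeRing R hiding (zero)
  open CatalanStieltjes R
  open Digraph r s t b cc n w
  open Motzkin R r s t
  open PathSums R r s t b cc n w
  open RingIdentities R
  open import Relation.Binary.Reasoning.Setoid setoid

  pW : BlockType → ℕ → Bool → Carrier × Carrier × Carrier
  pW type1 d onDiagonal = r d , T d , s d - r d - T d
  pW type2 d onDiagonal = 1# , (if onDiagonal then 0# else 1#) , s d - R- d - T (suc d)
  pW type3 d onDiagonal = 1# , T d , s d - R- d * T d - 1#
  pW type4 d onDiagonal = r d , (if onDiagonal then 0# else 1#) ,
                          (if onDiagonal then s 0 - r 0 * T 1 else s d - r d * T (suc d) - 1#)
  pW type5 d onDiagonal = 1# , b d , 0#

  qW : BlockType → ℕ → Carrier × Carrier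
  qW type1 d = 1# , 1#
  qW type2 d = r d , T (suc d)
  qW type3 d = r d , 1#
  qW type4 d = 1# , T (suc d)
  qW type5 d = 1# , cc d

  pWeights≡pW : ∀ ty m k → pWeights ty m k ≡ pW ty (m ∸ k) (k ≡ᵇ m)
  pWeights≡pW type1 m k = ≡.refl
  pWeights≡pW type2 m k = ≡.refl
  pWeights≡pW type3 m k = ≡.refl
  pWeights≡pW type4 m k = ≡.refl
  pWeights≡pW type5 m k = ≡.refl

  qWeights≡qW : ∀ ty m k → qWeights ty m k ≡ qW ty (m ∸ k)
  qWeights≡qW type1 m k = ≡.refl
  qWeights≡qW type2 m k = ≡.refl
  qWeights≡qW type3 m k = ≡.refl
  qWeights≡qW type4 m k = ≡.refl
  qWeights≡qW type5 m k = ≡.refl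

  interior-coefficients : ∀ ty d → (ty ≡ type5 → Type5Cond r s t b cc) →
    let (x , y , z) = pW ty (suc d) false
        (q₁ , q₂) = qW ty (suc d)
        (q₁′ , q₂′) = qW ty d
    in (x * q₁ ≈ r (suc d)) × (x * q₂ + y * q₁′ + z ≈ s (suc d)) × (y * q₂′ ≈ t (suc d))
  interior-coefficients type1 d _ =
    *-identityʳ _ , x+y+[s-x-y]≈s _ (+-cong (*-identityʳ _) (*-identityʳ _)) , *-identityʳ _
  interior-coefficients type2 d _ =
    *-identityˡ _ , x+y+[s-x-y]≈s _ (trans (+-cong (*-identityˡ _) (*-identityˡ _)) (+-comm _ _)) , *-identityˡ _
  interior-coefficients type3 d _ =
    *-identityˡ _ , x+y+[s-x-y]≈s _ (trans (+-comm _ _) (+-cong (*-comm _ _) (*-identityˡ _))) , *-identityʳ _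
  interior-coefficients type4 d _ =
    *-identityʳ _ , x+y+[s-x-y]≈s _ (+-congˡ (*-identityˡ _)) , *-identityˡ _
  interior-coefficients type5 d type5-cond =
    trans (*-identityˡ _) (sym r≈1) ,
    trans (+-identityʳ _) (trans (+-cong (*-identityˡ _) (*-identityʳ _)) (trans (+-comm _ _) (sym s≈b+c))) ,
    sym t≈bc
    where
    cond = type5-cond ≡.refl
    r≈1 = proj₁ (cond (suc d))
    s≈b+c = proj₁ (proj₂ (cond (suc d)))
    t≈bc = proj₂ (proj₂ (cond d))

  diagonal-coefficients : ∀ ty → (ty ≡ type5 → Type5Cond r s t b cc) →
    let (x , y , z) = pW ty 0 true
        (q₁ , q₂) = qW ty 0
    in (x * q₁ ≈ r 0) × (x * q₂ + y + z ≈ s 0)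
  diagonal-coefficients type1 _ = *-identityʳ _ , x+y+[s-x-y]≈s _ (+-congʳ (*-identityʳ _))
  diagonal-coefficients type2 _ = *-identityˡ _ , x+y+[s-x-y]≈s _ (trans (+-congʳ (*-identityˡ _)) (+-comm _ _))
  diagonal-coefficients type3 _ =
    *-identityˡ _ , x+y+[s-x-y]≈s _ (trans (+-comm _ _) (+-cong (sym (zeroˡ _)) (*-identityˡ _)))
  diagonal-coefficients type4 _ = *-identityʳ _ , trans (+-congʳ (+-identityʳ _)) (x+[s-x]≈s _ refl)
  diagonal-coefficients type5 type5-cond =
    trans (*-identityˡ _) (sym r≈1) ,
    trans (+-identityʳ _) (trans (+-cong (*-identityˡ _) refl) (trans (+-comm _ _) (sym s≈b+c)))
    where
    cond = type5-cond ≡.refl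
    r≈1 = proj₁ (cond 0)
    s≈b+c = proj₁ (proj₂ (cond 0))

  interior-step : ∀ ty d (p : Carrier × Carrier × Carrier) (q q′ : Carrier × Carrier) →
    p ≡ pW ty (suc d) false → q ≡ qW ty (suc d) → q′ ≡ qW ty d → (ty ≡ type5 → Type5Cond r s t b cc) →
    ∀ {HQ HQ′ HP A B C} →
    HQ ≈ proj₁ q * A + proj₂ q * B → HQ′ ≈ proj₁ q′ * B + proj₂ q′ * C → HP ≈ B →
    proj₁ p * HQ + (proj₁ (proj₂ p) * HQ′ + (proj₂ (proj₂ p) * HP + 0#))
      ≈ r (suc d) * A + s (suc d) * B + t (suc d) * C
  interior-step ty d _ _ _ ≡.refl ≡.refl ≡.refl type5-cond {A = A} {B} {C} HQ≈ HQ′≈ HP≈ =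
    let (x , y , z) = pW ty (suc d) false
        (q₁ , q₂) = qW ty (suc d)
        (q₁′ , q₂′) = qW ty d
        (up , level , down) = interior-coefficients ty d type5-cond
    in begin
    x * _ + (y * _ + (z * _ + 0#))
      ≈⟨ +-cong (*-congˡ HQ≈) (+-cong (*-congˡ HQ′≈) (+-congʳ (*-congˡ HP≈))) ⟩
    x * (q₁ * A + q₂ * B) + (y * (q₁′ * B + q₂′ * C) + (z * B + 0#))
      ≈⟨ collect₃ x y z q₁ q₂ q₁′ q₂′ A B C ⟩
    x * q₁ * A + (x * q₂ + y * q₁′ + z) * B + y * q₂′ * C
      ≈⟨ +-cong (+-cong (*-congʳ up) (*-congʳ level)) (*-congʳ down) ⟩
    r (suc d) * A + s (suc d) * B + t (suc d) * C ∎

  diagonal-step : ∀ ty (p : Carrier × Carrier × Carrier) (q : Carrier × Carrier) →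
    p ≡ pW ty 0 true → q ≡ qW ty 0 → (ty ≡ type5 → Type5Cond r s t b cc) →
    ∀ {HQ HQ′ HP A B} → HQ ≈ proj₁ q * A + proj₂ q * B → HQ′ ≈ B → HP ≈ B →
    proj₁ p * HQ + (proj₁ (proj₂ p) * HQ′ + (proj₂ (proj₂ p) * HP + 0#)) ≈ r 0 * A + s 0 * B + 0# * B
  diagonal-step ty _ _ ≡.refl ≡.refl type5-cond {A = A} {B} HQ≈ HQ′≈ HP≈ =
    let (x , y , z) = pW ty 0 true
        (q₁ , q₂) = qW ty 0
        (up , level) = diagonal-coefficients ty type5-cond
    in begin
    x * _ + (y * _ + (z * _ + 0#))
      ≈⟨ +-cong (*-congˡ HQ≈) (+-cong (*-congˡ HQ′≈) (+-congʳ (*-congˡ HP≈))) ⟩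
    x * (q₁ * A + q₂ * B) + (y * B + (z * B + 0#))
      ≈⟨ collect₂ x y z q₁ q₂ A B ⟩
    x * q₁ * A + (x * q₂ + y + z) * B
      ≈⟨ +-cong (*-congʳ up) (*-congʳ level) ⟩
    r 0 * A + s 0 * B
      ≈⟨ trans (+-congˡ (zeroˡ B)) (+-identityʳ _) ⟨
    r 0 * A + s 0 * B + 0# * B ∎

  out-P-inner : ∀ {m k} → m < n → k ≤ m → out (P m k) ≡
    (Q m k , proj₁ (pWeights (w m) m k)) ∷ (Q m (suc k) , proj₁ (proj₂ (pWeights (w m) m k)))
      ∷ (P (suc m) (suc k) , proj₂ (proj₂ (pWeights (w m) m k))) ∷ []
  out-P-inner {m} {k} m<n k≤m rewrite dec-true (m <? n) m<n | dec-true (k <? suc m) (s≤s k≤m) = ≡.refl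

  out-P-rim : ∀ {m} → m < n → out (P m (suc m)) ≡ (Q m (suc m) , 1#) ∷ []
  out-P-rim {m} m<n
    rewrite dec-true (m <? n) m<n | dec-false (suc m <? suc m) (ℕ.<-irrefl ≡.refl)
          | dec-true (suc m ≟ suc m) ≡.refl = ≡.refl

  out-P-outer : ∀ {m k} → m < n → suc m < k → k ≤ n → out (P m k) ≡ (P (suc m) k , 1#) ∷ []
  out-P-outer {m} {k} m<n sm<k k≤n
    rewrite dec-true (m <? n) m<n | dec-false (k <? suc m) (ℕ.<-asym sm<k)
          | dec-false (k ≟ suc m) (ℕ.>⇒≢ sm<k) | dec-true (k <? suc n) (s≤s k≤n) = ≡.refl

  out-P-last : ∀ {k} → out (P n k) ≡ []
  out-P-last rewrite dec-false (n <? n) (ℕ.<-irrefl ≡.refl) = ≡.refl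

  out-Q-inner : ∀ {m k} → m < n → k ≤ m → out (Q m k) ≡
    (P (suc m) k , proj₁ (qWeights (w m) m k)) ∷ (P (suc m) (suc k) , proj₂ (qWeights (w m) m k)) ∷ []
  out-Q-inner {m} {k} m<n k≤m rewrite dec-true (m <? n) m<n | dec-true (k <? suc m) (s≤s k≤m) = ≡.refl

  out-Q-rim : ∀ {m} → m < n → out (Q m (suc m)) ≡ (P (suc m) (suc m) , 1#) ∷ []
  out-Q-rim {m} m<n
    rewrite dec-true (m <? n) m<n | dec-false (suc m <? suc m) (ℕ.<-irrefl ≡.refl)
          | dec-true (suc m ≟ suc m) ≡.refl = ≡.refl

  module _ {j} (j≤n : j ≤ n) (type5-cond : ∀ m → m < n → w m ≡ type5 → Type5Cond r s t b cc) where
    v : Vertex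
    v = P n (n ∸ j)

    target-indicator : ∀ {k d} → k ≤ n → n ∸ k ≡ d → (if P n k ==V v then 1# else 0#) ≡ δ d j
    target-indicator {k} k≤n ≡.refl rewrite dec-true (n ≟ n) ≡.refl =
      ≡.cong (λ bo → if bo then 1# else 0#) (does-⇔ (mk⇔ to from) (k ≟ n ∸ j) (n ∸ k ≟ j))
      where
      to : k ≡ n ∸ j → n ∸ k ≡ j
      to k≡ = ≡.trans (≡.cong (n ∸_) k≡) (ℕ.m∸[m∸n]≡n j≤n)
      from : n ∸ k ≡ j → k ≡ n ∸ j
      from ≡j = ≡.trans (≡.sym (ℕ.m∸[m∸n]≡n k≤n)) (≡.cong (n ∸_) ≡j)

    P-off-target : ∀ {m k} → m < n → (P m k ==V v) ≡ false
    P-off-target {m} m<n rewrite dec-false (m ≟ n) (ℕ.<⇒≢ m<n) = ≡.refl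

    GF<-suc : ∀ L u {xs} → out u ≡ xs →
              GF< (suc L) u v ≡ (if u ==V v then 1# else 0#) + sumOver xs (λ x → GF< L x v)
    GF<-suc L u ≡.refl = ≡.refl

    GF<-suc-away : ∀ L u {xs} → out u ≡ xs → (u ==V v) ≡ false →
                   GF< (suc L) u v ≈ sumOver xs (λ x → GF< L x v)
    GF<-suc-away L u ≡.refl u≢v rewrite u≢v = +-identityˡ _

    level<n : ∀ {N m} → N ℕ.+ suc m ≡ n → m < n
    level<n {N} {m} eq = ≡.subst (m <_) eq (ℕ.m≤n+m (suc m) N)

    -- From level m = n − N at most N + N arcs lead on, which bounds the fuel needed.
    GF<-P-inner : ∀ L {m k N d} → N ℕ.+ m ≡ n → k ≤ m → m ∸ k ≡ d → N ℕ.+ N < L →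
                  GF< L (P m k) v ≈ motzkin N d j
    GF<-P-outer : ∀ L {m k M N} → M ℕ.+ m ≡ n → N ℕ.+ k ≡ n → m < k → M ℕ.+ M < L →
                  GF< L (P m k) v ≈ motzkin N 0 j
    GF<-Q-inner : ∀ L {m k N d} → N ℕ.+ suc m ≡ n → k ≤ m → m ∸ k ≡ d → suc (N ℕ.+ N) < L →
                  GF< L (Q m k) v ≈ proj₁ (qWeights (w m) m k) * motzkin N (suc d) j
                                    + proj₂ (qWeights (w m) m k) * motzkin N d j
    GF<-Q-rim : ∀ L {m N} → N ℕ.+ suc m ≡ n → suc (N ℕ.+ N) < L → GF< L (Q m (suc m)) v ≈ motzkin N 0 j

    GF<-P-inner (suc L) {k = k} {zero} ≡.refl k≤n d≡ _ =
      trans (reflexive (GF<-suc L (P n k) (out-P-last {k})))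
            (trans (+-identityʳ _) (reflexive (target-indicator k≤n d≡)))
    GF<-P-inner (suc L) {m} {k} {suc N} {d} eq k≤m d≡ (s≤s fuel) with ℕ.m≤n⇒m<n∨m≡n k≤m
    ... | inj₁ k<m = begin
      GF< (suc L) (P m k) v
        ≈⟨ GF<-suc-away L (P m k) (out-P-inner m<n k≤m) (P-off-target {k = k} m<n) ⟩
      _ ≈⟨ interior-step (w m) (m ∸ suc k) _ _ _ p≡ q≡ (qWeights≡qW (w m) m (suc k)) (type5-cond m m<n)
             (GF<-Q-inner L eq′ k≤m d′≡ fuelQ) (GF<-Q-inner L eq′ k<m ≡.refl fuelQ)
             (GF<-P-inner L eq′ (s≤s k≤m) d′≡ (ℕ.<⇒≤ fuelQ)) ⟩
      motzkin (suc N) (suc (m ∸ suc k)) j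
        ≡⟨ ≡.cong (λ e → motzkin (suc N) e j) (≡.trans (≡.sym d′≡) d≡) ⟩
      motzkin (suc N) d j ∎
      where
      eq′ = ≡.trans (ℕ.+-suc N m) eq
      m<n = level<n eq′
      fuelQ = ≡.subst (λ x → suc x ≤ L) (ℕ.+-suc N N) fuel
      d′≡ : m ∸ k ≡ suc (m ∸ suc k)
      d′≡ = ℕ.+-∸-assoc 1 k<m
      p≡ = ≡.trans (pWeights≡pW (w m) m k) (≡.cong₂ (pW (w m)) d′≡ (dec-false (k ≟ m) (ℕ.<⇒≢ k<m)))
      q≡ = ≡.trans (qWeights≡qW (w m) m k) (≡.cong (qW (w m)) d′≡)
    ... | inj₂ ≡.refl = begin
      GF< (suc L) (P m m) v
        ≈⟨ GF<-suc-away L (P m m) (out-P-inner m<n k≤m) (P-off-target {k = m} m<n) ⟩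
      _ ≈⟨ diagonal-step (w m) _ _ p≡ q≡ (type5-cond m m<n)
             (GF<-Q-inner L eq′ k≤m (ℕ.n∸n≡0 m) fuelQ) (GF<-Q-rim L eq′ fuelQ)
             (GF<-P-inner L eq′ ℕ.≤-refl (ℕ.n∸n≡0 m) (ℕ.<⇒≤ fuelQ)) ⟩
      motzkin (suc N) 0 j
        ≡⟨ ≡.cong (λ e → motzkin (suc N) e j) (≡.trans (≡.sym (ℕ.n∸n≡0 m)) d≡) ⟩
      motzkin (suc N) d j ∎
      where
      eq′ = ≡.trans (ℕ.+-suc N m) eq
      m<n = level<n eq′
      fuelQ = ≡.subst (λ x → suc x ≤ L) (ℕ.+-suc N N) fuel
      p≡ = ≡.trans (pWeights≡pW (w m) m m) (≡.cong₂ (pW (w m)) (ℕ.n∸n≡0 m) (dec-true (m ≟ m) ≡.refl))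
      q≡ = ≡.trans (qWeights≡qW (w m) m m) (≡.cong (qW (w m)) (ℕ.n∸n≡0 m))

    GF<-P-outer (suc L) {M = zero} ≡.refl eqN n<k _ =
      ⊥-elim (ℕ.<⇒≱ n<k (≡.subst (_ ≤_) eqN (ℕ.m≤n+m _ _)))
    GF<-P-outer (suc L) {m} {k} {suc M} {N} eqM eqN m<k (s≤s fuel) with ℕ.m≤n⇒m<n∨m≡n m<k
    ... | inj₂ ≡.refl = begin
      GF< (suc L) (P m (suc m)) v
        ≈⟨ GF<-suc-away L (P m (suc m)) (out-P-rim m<n) (P-off-target {k = suc m} m<n) ⟩
      1# * GF< L (Q m (suc m)) v + 0#
        ≈⟨ trans (+-identityʳ _) (*-identityˡ _) ⟩
      GF< L (Q m (suc m)) v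
        ≈⟨ GF<-Q-rim L eqN (≡.subst (λ x → suc (x ℕ.+ x) < L) (≡.sym N≡M) fuelQ) ⟩
      motzkin N 0 j ∎
      where
      eqM′ = ≡.trans (ℕ.+-suc M m) eqM
      m<n = level<n eqM′
      N≡M = ℕ.+-cancelʳ-≡ (suc m) N M (≡.trans eqN (≡.sym eqM′))
      fuelQ = ≡.subst (λ x → suc x ≤ L) (ℕ.+-suc M M) fuel
    ... | inj₁ sm<k = begin
      GF< (suc L) (P m k) v
        ≈⟨ GF<-suc-away L (P m k) (out-P-outer m<n sm<k k≤n) (P-off-target {k = k} m<n) ⟩
      1# * GF< L (P (suc m) k) v + 0#
        ≈⟨ trans (+-identityʳ _) (*-identityˡ _) ⟩
      GF< L (P (suc m) k) v
        ≈⟨ GF<-P-outer L eqM′ eqN sm<k (ℕ.<⇒≤ (≡.subst (λ x → suc x ≤ L) (ℕ.+-suc M M) fuel)) ⟩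
      motzkin N 0 j ∎
      where
      eqM′ = ≡.trans (ℕ.+-suc M m) eqM
      m<n = level<n eqM′
      k≤n = ≡.subst (k ≤_) eqN (ℕ.m≤n+m k N)

    GF<-Q-inner (suc L) {m} {k} {N} {d} eq k≤m d≡ (s≤s fuel) = begin
      GF< (suc L) (Q m k) v
        ≈⟨ GF<-suc-away L (Q m k) (out-Q-inner (level<n eq) k≤m) ≡.refl ⟩
      q₁ * GF< L (P (suc m) k) v + (q₂ * GF< L (P (suc m) (suc k)) v + 0#)
        ≈⟨ +-cong (*-congˡ (GF<-P-inner L eq (ℕ.m≤n⇒m≤1+n k≤m)
                                         (≡.trans (ℕ.+-∸-assoc 1 k≤m) (≡.cong suc d≡)) fuel))
                  (trans (+-identityʳ _) (*-congˡ (GF<-P-inner L eq (s≤s k≤m) d≡ fuel))) ⟩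
      q₁ * motzkin N (suc d) j + q₂ * motzkin N d j ∎
      where
      q₁ = proj₁ (qWeights (w m) m k)
      q₂ = proj₂ (qWeights (w m) m k)

    GF<-Q-rim (suc L) {m} {N} eq (s≤s fuel) = begin
      GF< (suc L) (Q m (suc m)) v
        ≈⟨ GF<-suc-away L (Q m (suc m)) (out-Q-rim (level<n eq)) ≡.refl ⟩
      1# * GF< L (P (suc m) (suc m)) v + 0#
        ≈⟨ trans (+-identityʳ _) (*-identityˡ _) ⟩
      GF< L (P (suc m) (suc m)) v
        ≈⟨ GF<-P-inner L eq ℕ.≤-refl (ℕ.n∸n≡0 m) fuel ⟩
      motzkin N 0 j ∎

    GF≈motzkin : ∀ {i} → i ≤ n → GF (P 0 (n ∸ i)) v ≈ motzkin i 0 j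
    GF≈motzkin {i} i≤n with ℕ.m≤n⇒m<n∨m≡n i≤n
    ... | inj₁ i<n = trans (GF≈GF< _ v)
      (GF<-P-outer (suc (n ℕ.+ n)) (ℕ.+-identityʳ n) (ℕ.m+[n∸m]≡n i≤n) (ℕ.m<n⇒0<n∸m i<n) ℕ.≤-refl)
    ... | inj₂ ≡.refl = trans (GF≈GF< _ v)
      (GF<-P-inner (suc (n ℕ.+ n)) (ℕ.+-identityʳ n) (ℕ.≤-reflexive (ℕ.n∸n≡0 n)) (ℕ.0∸n≡0 (n ∸ n))
                   ℕ.≤-refl)

theorem2p3 : ∀ {c ℓ} (R : CommutativeRing c ℓ) →
    (r s t b cc : ℕ → CommutativeRing.Carrier R) (n : ℕ) → 1 ≤ n →
    (w : ℕ → BlockType) →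
    (∀ m → m < n → w m ≡ type5 → CatalanStieltjes.Type5Cond R r s t b cc) →
    ∀ i j → i ≤ n → j ≤ n →
    CommutativeRing._≈_ R
      (CatalanStieltjes.csMatrix R r s t i j)
      (CatalanStieltjes.Digraph.GF R r s t b cc n w (P 0 (n ∸ i)) (P n (n ∸ j)))
theorem2p3 R r s t b cc n _ w type5-cond i j i≤n j≤n =
  trans (csMatrix≈motzkin i j) (sym (GF≈motzkin j≤n type5-cond i≤n))
  where
  open CommutativeRing R using (trans; sym)
  open Motzkin R r s t using (csMatrix≈motzkin)
  open DigraphGF R r s t b cc n w using (GF≈motzkin)
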